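{- If $\phi$ is an SLTL formula of alternation depth $1$, then for every SLTL structure $\mathfrak T$: $\mathfrak T\models^{\mathrm{pobs}}\phi$ iff $\mathfrak T\models^{\mathrm{decr}}\phi$ iff $\mathfrak T\models^{\mathrm{incr}}\phi$. Moreover, for each $\models\in\{\models^{\mathrm{step}},\models^{\mathrm{public}}\}$ there exist an SLTL structure $\mathfrak T$ and an SLTL formula $\phi$ of alternation depth $1$ such that $\mathfrak T\models^{\mathrm{pobs}}\phi$ and $\mathfrak T\models\phi$ have different truth values; and there exist an SLTL structure $\mathfrak T$ and an SLTL formula $\phi$ of alternation depth $1$ such that $\mathfrak T\models^{\mathrm{public}}\phi$ and $\mathfrak T\models^{\mathrm{step}}\phi$ have different truth values.
   Context: Fix finite sets $P$ (atomic propositions) and $\mathit{Ag}$ (agents). For a finite or infinite word $\varsigma$ over $2^P$ and $R\subseteq P$, $\varsigma|_R$ is obtained by intersecting every letter with $R$; $\mathit{first}(\varsigma)$, $\mathit{last}(\varsigma)$ are the first and last letters; for $f=H_0H_1\cdots$, $f[i]=H_i$, $f[i..j]=H_i\cdots H_j$ (empty if $i>j$), $f[j..]=H_jH_{j+1}\cdots$. A transition system is $\mathcal T=(S,\to,\mathit{Init},R,L)$ with $S$ finite, $\to\subseteq S\times S$ total, $\mathit{Init}\subseteq S$, $R$ a finite set of propositions and $L:S\to2^R$. $\mathit{trace}(s_0s_1\cdots)=L(s_0)L(s_1)\cdots$; $\mathit{Traces}(\mathcal T,s)$ is the set of traces of infinite paths from $s$, $\mathit{Traces}(\mathcal T)$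 the union over $s\in\mathit{Init}$; for $P\supseteq R$, $\mathit{Traces}^P(\mathcal T,s)=\{\rho\in(2^P)^\omega:\rho|_R\in\mathit{Traces}(\mathcal T,s)\}$; for $h\in(2^P)^+$, $\mathit{Reach}(\mathcal T,h)$ is the set of states $s$ such that some finite path from $\mathit{Init}$ ends in $s$ with trace $h|_R$. SLTL formulas: $\varphi::=\mathit{true}\mid p\mid\neg\varphi\mid\varphi_1\wedge\varphi_2\mid\bigcirc\varphi\mid\varphi_1\,\mathrm U\,\varphi_2\mid\langle a\rangle\varphi$ ($p\in P$, $a\in\mathit{Ag}$). An SLTL structure is $\mathfrak T=(\mathcal T_0,(\mathcal T_a)_{a\in\mathit{Ag}})$ with $\mathcal T_0=(S_0,\to_0,\{\mathit{init}_0\},P,L_0)$ and $\mathcal T_a=(S_a,\to_a,\{\mathit{init}_a\},P_a,L_a)$, $P_a\subseteq P$. Semantics over pairs $(f,h)\in(2^P)^\omega\times(2^P)^+$ with $\mathit{last}(h)=\mathit{first}(f)$: $(f,h)\models\mathit{true}$; $(f,h)\models p$ iff $p\in f[0]$; usual clauses for $\neg,\wedge$; $(f,h)\models\bigcirc\varphi$ iff $(f[1..],h\,f[1])\models\varphi$; $(f,h)\models\varphi_1\mathrm U\varphi_2$ iff there is $\ell$ with $(f[\ell..],h\,f[1..\ell])\models\varphi_2$ and $(f[j..],h\,f[1..j])\models\varphi_1$ for all $j<\ell$. $(f,h)\models\langle a\rangle\varphi$ iff there exist $h'\in(2^P)^+$, $t\in\mathit{Reach}(\mathcal T_a,h')$,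 $f'\in\mathit{Traces}^P(\mathcal T_a,t)$ with $\mathit{last}(h')=\mathit{first}(f')$, $h|_{\mathfrak O}=h'|_{\mathfrak O}$ and $(f',h')\models'\varphi$, where: step semantics $\models^{\mathrm{step}}$: $\mathfrak O=\emptyset$, $\models'=\models^{\mathrm{step}}$; pure observation-based $\models^{\mathrm{pobs}}$: $\mathfrak O=P_a$, $\models'=\models^{\mathrm{pobs}}$; public-history $\models^{\mathrm{public}}$: $\mathfrak O=P$, $\models'=\models^{\mathrm{public}}$; decremental $\models^{\mathrm{decr}}_Q$: $\mathfrak O=Q\cap P_a$, $\models'=\models^{\mathrm{decr}}_{Q\cap P_a}$; incremental $\models^{\mathrm{incr}}_Q$: $\mathfrak O=Q\cup P_a$, $\models'=\models^{\mathrm{incr}}_{Q\cup P_a}$ ($Q$ unchanged in other clauses). Satisfaction over a structure: $\mathfrak T\models\phi$ iff $(f,\mathit{first}(f))\models_*\phi$ for all $f\in\mathit{Traces}(\mathcal T_0)$, where $\models_*$ is $\models^{\mathrm{step}}$, $\models^{\mathrm{pobs}}$, $\models^{\mathrm{public}}$ for those semantics, $\models^{\mathrm{decr}}_P$ for $\mathfrak T\models^{\mathrm{decr}}\phi$ and $\models^{\mathrm{incr}}_\emptyset$ for $\mathfrak T\models^{\mathrm{incr}}\phi$. Alternation depth $\mathit{ad}$: $\mathit{ad}(\mathit{true})=\mathit{ad}(p)=0$; $\mathit{ad}(\varphi_1\wedge\varphi_2)=\mathit{ad}(\varphi_1\mathrm U\varphi_2)=\max(\mathit{ad}(\varphi_1),\mathit{ad}(\varphi_2))$;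 $\mathit{ad}(\neg\varphi)=\mathit{ad}(\bigcirc\varphi)=\mathit{ad}(\varphi)$. For $\langle a\rangle\varphi$: if $\varphi$ has no standpoint modality, $\mathit{ad}=1$; otherwise, letting $\chi_i=\langle b_i\rangle\psi_i$ ($i=1..k$) be the maximal standpoint subformulas of $\varphi$ (those not in the scope of another standpoint modality inside $\varphi$), $\mathit{ad}(\langle a\rangle\varphi)$ is the maximum of $\mathit{ad}(\chi_i)$ over $i$ with $b_i=a$ and of $\mathit{ad}(\chi_i)+1$ over $i$ with $b_i\neq a$. -}

module Defs where

open import Data.Nat using (ℕ; zero; suc; _+_; _⊔_; _<_)
open import Data.Fin using (Fin) renaming (_≟_ to _≟ᶠ_)
open import Data.Fin.Subset using (Subset; _∩_; _∪_; _⊆_) renaming (⊥ to ∅; ⊤ to Full)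
open import Data.Bool using (Bool; true; false; if_then_else_)
open import Data.List using (List; []; _∷_)
open import Data.List.NonEmpty using (List⁺; _∷_; _⁺∷ʳ_; last; [_]) renaming (map to map⁺)
open import Data.Product using (Σ; ∃; _×_; _,_)
open import Relation.Binary.PropositionalEquality using (_≡_)
open import Relation.Nullary using (¬_; does)
open import Function.Bundles using (_⇔_)

-- Propositions P = Fin n, agents Ag = Fin m.
-- Letters of 2^P are subsets  Subset n  (= Vec Bool n); restriction ς|_R is  _∩ R.
Letter : ℕ → Set
Letter n = Subset n

Word : ℕ → Set
Word n = ℕ → Letter n

FWord : ℕ → Set
FWord n = List⁺ (Letter n)

shift : ∀ {n} → ℕ → Word n → Word n
shift k f i = f (k + i)

ext : ∀ {n} → FWord n → Word n → ℕ → FWord n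
ext h f zero    = h
ext h f (suc ℓ) = ext h f ℓ ⁺∷ʳ f (suc ℓ)

record TS (n : ℕ) : Set where
  field
    size  : ℕ
    step  : Fin size → Fin size → Bool
    total : ∀ s → ∃ λ t → step s t ≡ true
    init  : Fin size
    R     : Subset n
    L     : Fin size → Subset n
    L⊆R   : ∀ s → L s ⊆ R

module _ {n : ℕ} (T : TS n) where
  open TS T

  IsPath : Fin size → (ℕ → Fin size) → Set
  IsPath s π = (π 0 ≡ s) × (∀ i → step (π i) (π (suc i)) ≡ true)

  Traces : Fin size → Word n → Set
  Traces s ρ = ∃ λ (π : ℕ → Fin size) → IsPath s π × (∀ i → L (π i) ≡ ρ i)

  TracesP : Fin size → Word n → Set
  TracesP s ρ = Traces s (λ i → ρ i ∩ R)

  Run : Fin size → Letter n → List (Letter n) → Fin size → Set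
  Run s x []       t = (L s ≡ x ∩ R) × (s ≡ t)
  Run s x (y ∷ ys) t = (L s ≡ x ∩ R) × ∃ λ s′ → (step s s′ ≡ true) × Run s′ y ys t

  Reach : FWord n → Fin size → Set
  Reach (x ∷ xs) t = Run init x xs t

data Formula (n m : ℕ) : Set where
  tt   : Formula n m
  var  : Fin n → Formula n m
  ¬′_  : Formula n m → Formula n m
  _∧′_ : Formula n m → Formula n m → Formula n m
  ○_   : Formula n m → Formula n m
  _U_  : Formula n m → Formula n m → Formula n m
  ⟨_⟩_ : Fin m → Formula n m → Formula n m

-- SLTL structures: T₀ has R = P; Tₐ has Pₐ = R(Tₐ) ⊆ P.
record Structure (n m : ℕ) : Set where
  field
    T₀   : TS n
    T₀-R : TS.R T₀ ≡ Full
    Tₐ   : Fin m → TS n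

-- Generic semantics: given current parameter Q and agent propositions Pₐ,
-- upd Q Pₐ is both the observed set 𝔒 and the parameter used below ⟨a⟩.
Sat : ∀ {n m} → Structure n m → (Subset n → Subset n → Subset n) →
      Subset n → Formula n m → Word n → FWord n → Set
Sat 𝔗 upd Q tt f h = Data.Unit.⊤ where import Data.Unit
Sat 𝔗 upd Q (var p) f h = p Data.Fin.Subset.∈ f 0
Sat 𝔗 upd Q (¬′ φ) f h = ¬ Sat 𝔗 upd Q φ f h
Sat 𝔗 upd Q (φ ∧′ ψ) f h = Sat 𝔗 upd Q φ f h × Sat 𝔗 upd Q ψ f h
Sat 𝔗 upd Q (○ φ) f h = Sat 𝔗 upd Q φ (shift 1 f) (h ⁺∷ʳ f 1)
Sat 𝔗 upd Q (φ U ψ) f h =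
  ∃ λ ℓ → Sat 𝔗 upd Q ψ (shift ℓ f) (ext h f ℓ)
        × (∀ j → j < ℓ → Sat 𝔗 upd Q φ (shift j f) (ext h f j))
Sat {n} 𝔗 upd Q (⟨ a ⟩ φ) f h =
  ∃ λ (h′ : FWord n) → ∃ λ (t : Fin (TS.size Ta)) → ∃ λ (f′ : Word n) →
      Reach Ta h′ t × TracesP Ta t f′ × (last h′ ≡ f′ 0)
    × (map⁺ (_∩ Q′) h ≡ map⁺ (_∩ Q′) h′) × Sat 𝔗 upd Q′ φ f′ h′
  where
    Ta = Structure.Tₐ 𝔗 a
    Q′ = upd Q (TS.R Ta)

Models : ∀ {n m} → Structure n m → (Subset n → Subset n → Subset n) →
         Subset n → Formula n m → Set
Models 𝔗 upd Q₀ φ =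
  ∀ f → Traces T₀ (TS.init T₀) f → Sat 𝔗 upd Q₀ φ f [ f 0 ]
  where T₀ = Structure.T₀ 𝔗

_⊨step_ _⊨pobs_ _⊨public_ _⊨decr_ _⊨incr_ : ∀ {n m} → Structure n m → Formula n m → Set
𝔗 ⊨step φ   = Models 𝔗 (λ _ _ → ∅) ∅ φ
𝔗 ⊨pobs φ   = Models 𝔗 (λ _ Pa → Pa) ∅ φ
𝔗 ⊨public φ = Models 𝔗 (λ _ _ → Full) ∅ φ
𝔗 ⊨decr φ   = Models 𝔗 (λ Q Pa → Q ∩ Pa) Full φ
𝔗 ⊨incr φ   = Models 𝔗 (λ Q Pa → Q ∪ Pa) ∅ φ

hasSP : ∀ {n m} → Formula n m → Bool
hasSP tt = false
hasSP (var p) = false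
hasSP (¬′ φ) = hasSP φ
hasSP (φ ∧′ ψ) = hasSP φ Data.Bool.∨ hasSP ψ
hasSP (○ φ) = hasSP φ
hasSP (φ U ψ) = hasSP φ Data.Bool.∨ hasSP ψ
hasSP (⟨ a ⟩ φ) = true

mutual
  adSP : ∀ {n m} → Fin m → Formula n m → ℕ
  adSP a φ = if hasSP φ then adIn a φ else 1

  -- max over maximal standpoint subformulas ⟨b⟩ψ of φ of ad(⟨b⟩ψ) (+1 if b ≠ a);
  -- 0 if there are none (only used when there is at least one)
  adIn : ∀ {n m} → Fin m → Formula n m → ℕ
  adIn a tt = 0
  adIn a (var p) = 0
  adIn a (¬′ φ) = adIn a φ
  adIn a (φ ∧′ ψ) = adIn a φ ⊔ adIn a ψ
  adIn a (○ φ) = adIn a φ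
  adIn a (φ U ψ) = adIn a φ ⊔ adIn a ψ
  adIn a (⟨ b ⟩ ψ) = if does (b ≟ᶠ a) then adSP b ψ else suc (adSP b ψ)

ad : ∀ {n m} → Formula n m → ℕ
ad tt = 0
ad (var p) = 0
ad (¬′ φ) = ad φ
ad (φ ∧′ ψ) = ad φ ⊔ ad ψ
ad (○ φ) = ad φ
ad (φ U ψ) = ad φ ⊔ ad ψ
ad (⟨ a ⟩ φ) = adSP a φ

Differ : Set → Set → Set
Differ A B = (A × ¬ B) Data.Sum.⊎ (¬ A × B) where import Data.Sum

{-# OPTIONS --safe #-}
module Submission where

open import Defs
open import Data.Nat using (ℕ; _≤_; z≤n; s≤s; s≤s⁻¹)
open import Data.Nat.Properties using (≤-trans; ≤-reflexive; m⊔n≤o⇒m≤o; m⊔n≤o⇒n≤o; m≤n⇒m≤n⊔o; m≤n⇒m≤o⊔n)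
open import Data.Bool using (true; false)
open import Data.Bool.Properties using (∨-conicalˡ; ∨-conicalʳ)
open import Data.Fin using (Fin; zero) renaming (_≟_ to _≟ᶠ_)
open import Data.Fin.Subset using (Subset; _∩_; _∪_; _∈_; _⊆_) renaming (⊥ to ∅; ⊤ to Full)
open import Data.Fin.Subset.Properties using (∉⊥; ∈⊤; ⊆-min; ⊆-refl; ∩-zeroˡ; ∩-zeroʳ; ∩-identityˡ; ∩-identityʳ; ∩-idem; ∪-identityˡ; ∪-idem)
open import Data.List.NonEmpty using ([_]; last) renaming (map to map⁺)
open import Data.List.NonEmpty.Properties using (map-cong; map-id)
open import Data.Product using (∃; _×_; _,_)
open import Data.Sum using (inj₁; inj₂)
open import Data.Unit using (⊤)
open import Function using (_∘_)
open import Function.Bundles using (_⇔_; mk⇔)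
open import Relation.Nullary using (¬_; yes; no; contradiction)
open import Relation.Binary.PropositionalEquality using (_≡_; refl; sym; trans; cong; subst; module ≡-Reasoning)

-- Under the pure observation-based, decremental and incremental semantics, an agent's
-- outermost standpoint modality ⟨a⟩ compares histories on exactly Pₐ, and below it every
-- further ⟨a⟩ again compares on Pₐ. At alternation depth 1 no modality is nested under
-- one of a different agent, so the three semantics impose the same constraints everywhere.
-- The separating examples use ⟨a⟩¬p where p holds: under step semantics the agent may
-- always doubt p, under full observation of the history it never may, and under pure
-- observation it may exactly when it does not observe p.

Update : ℕ → Set
Update n = Subset n → Subset n → Subset n

data NonAlternating {n m} (A : Fin m → Set) : Formula n m → Set where
  tt   : NonAlternating A tt
  var  : ∀ p → NonAlternating A (var p)
  ¬′_  : ∀ {φ} → NonAlternating A φ → NonAlternating A (¬′ φ)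
  _∧′_ : ∀ {φ ψ} → NonAlternating A φ → NonAlternating A ψ → NonAlternating A (φ ∧′ ψ)
  ○_   : ∀ {φ} → NonAlternating A φ → NonAlternating A (○ φ)
  _U_  : ∀ {φ ψ} → NonAlternating A φ → NonAlternating A ψ → NonAlternating A (φ U ψ)
  ⟨_⟩_ : ∀ {a φ} → A a → NonAlternating (_≡ a) φ → NonAlternating A (⟨ a ⟩ φ)

module _ {n m : ℕ} where

  mutual
    1≤adSP : (a : Fin m) (φ : Formula n m) → 1 ≤ adSP a φ
    1≤adSP a φ with hasSP φ in hasSP≡
    ... | true  = 1≤adIn a φ hasSP≡
    ... | false = s≤s z≤n

    1≤adIn : (a : Fin m) (φ : Formula n m) → hasSP φ ≡ true → 1 ≤ adIn a φ
    1≤adIn a (¬′ φ) hasSP≡ = 1≤adIn a φ hasSP≡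
    1≤adIn a (φ ∧′ ψ) hasSP≡ with hasSP φ in hasSPφ≡
    ... | true  = m≤n⇒m≤n⊔o (adIn a ψ) (1≤adIn a φ hasSPφ≡)
    ... | false = m≤n⇒m≤o⊔n (adIn a φ) (1≤adIn a ψ hasSP≡)
    1≤adIn a (○ φ) hasSP≡ = 1≤adIn a φ hasSP≡
    1≤adIn a (φ U ψ) hasSP≡ with hasSP φ in hasSPφ≡
    ... | true  = m≤n⇒m≤n⊔o (adIn a ψ) (1≤adIn a φ hasSPφ≡)
    ... | false = m≤n⇒m≤o⊔n (adIn a φ) (1≤adIn a ψ hasSP≡)
    1≤adIn a (⟨ b ⟩ ψ) _ with b ≟ᶠ a
    ... | yes _ = 1≤adSP b ψ
    ... | no _  = s≤s z≤n

  hasSP≡false⇒nonAlternating : ∀ {A} (φ : Formula n m) → hasSP φ ≡ false → NonAlternating A φ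
  hasSP≡false⇒nonAlternating tt       _ = tt
  hasSP≡false⇒nonAlternating (var p)  _ = var p
  hasSP≡false⇒nonAlternating (¬′ φ)   e = ¬′ hasSP≡false⇒nonAlternating φ e
  hasSP≡false⇒nonAlternating (φ ∧′ ψ) e =
    hasSP≡false⇒nonAlternating φ (∨-conicalˡ _ _ e) ∧′ hasSP≡false⇒nonAlternating ψ (∨-conicalʳ _ _ e)
  hasSP≡false⇒nonAlternating (○ φ)    e = ○ hasSP≡false⇒nonAlternating φ e
  hasSP≡false⇒nonAlternating (φ U ψ)  e =
    hasSP≡false⇒nonAlternating φ (∨-conicalˡ _ _ e) U hasSP≡false⇒nonAlternating ψ (∨-conicalʳ _ _ e)

  mutual
    adSP≤1⇒nonAlternating : (a : Fin m) (φ : Formula n m) → adSP a φ ≤ 1 → NonAlternating (_≡ a) φ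
    adSP≤1⇒nonAlternating a φ ad≤1 with hasSP φ in hasSP≡
    ... | true  = adIn≤1⇒nonAlternating a φ ad≤1
    ... | false = hasSP≡false⇒nonAlternating φ hasSP≡

    adIn≤1⇒nonAlternating : (a : Fin m) (φ : Formula n m) → adIn a φ ≤ 1 → NonAlternating (_≡ a) φ
    adIn≤1⇒nonAlternating a tt       _    = tt
    adIn≤1⇒nonAlternating a (var p)  _    = var p
    adIn≤1⇒nonAlternating a (¬′ φ)   ad≤1 = ¬′ adIn≤1⇒nonAlternating a φ ad≤1
    adIn≤1⇒nonAlternating a (φ ∧′ ψ) ad≤1 =
      adIn≤1⇒nonAlternating a φ (m⊔n≤o⇒m≤o _ _ ad≤1) ∧′ adIn≤1⇒nonAlternating a ψ (m⊔n≤o⇒n≤o _ _ ad≤1)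
    adIn≤1⇒nonAlternating a (○ φ)    ad≤1 = ○ adIn≤1⇒nonAlternating a φ ad≤1
    adIn≤1⇒nonAlternating a (φ U ψ)  ad≤1 =
      adIn≤1⇒nonAlternating a φ (m⊔n≤o⇒m≤o _ _ ad≤1) U adIn≤1⇒nonAlternating a ψ (m⊔n≤o⇒n≤o _ _ ad≤1)
    adIn≤1⇒nonAlternating a (⟨ b ⟩ ψ) ad≤1 with b ≟ᶠ a
    ... | yes refl = ⟨ refl ⟩ adSP≤1⇒nonAlternating b ψ ad≤1
    ... | no _     = contradiction (≤-trans (1≤adSP b ψ) (s≤s⁻¹ ad≤1)) λ ()

  ad≤1⇒nonAlternating : (φ : Formula n m) → ad φ ≤ 1 → NonAlternating (λ _ → ⊤) φ
  ad≤1⇒nonAlternating tt        _    = tt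
  ad≤1⇒nonAlternating (var p)   _    = var p
  ad≤1⇒nonAlternating (¬′ φ)    ad≤1 = ¬′ ad≤1⇒nonAlternating φ ad≤1
  ad≤1⇒nonAlternating (φ ∧′ ψ)  ad≤1 =
    ad≤1⇒nonAlternating φ (m⊔n≤o⇒m≤o _ _ ad≤1) ∧′ ad≤1⇒nonAlternating ψ (m⊔n≤o⇒n≤o _ _ ad≤1)
  ad≤1⇒nonAlternating (○ φ)     ad≤1 = ○ ad≤1⇒nonAlternating φ ad≤1
  ad≤1⇒nonAlternating (φ U ψ)   ad≤1 =
    ad≤1⇒nonAlternating φ (m⊔n≤o⇒m≤o _ _ ad≤1) U ad≤1⇒nonAlternating ψ (m⊔n≤o⇒n≤o _ _ ad≤1)
  ad≤1⇒nonAlternating (⟨ a ⟩ φ) ad≤1 = ⟨ _ ⟩ adSP≤1⇒nonAlternating a φ ad≤1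

module _ {n m : ℕ} (𝔗 : Structure n m) where

  Pₐ : Fin m → Subset n
  Pₐ a = TS.R (Structure.Tₐ 𝔗 a)

  ObservesOwn : Update n → Subset n → (Fin m → Set) → Set
  ObservesOwn upd Q A = ∀ {a} → A a → upd Q (Pₐ a) ≡ Pₐ a

  KeepsOwn : Update n → Set
  KeepsOwn upd = ∀ a → upd (Pₐ a) (Pₐ a) ≡ Pₐ a

  ObservationBased : Update n → Subset n → Set
  ObservationBased upd Q = KeepsOwn upd × ObservesOwn upd Q (λ _ → ⊤)

  observesOwn-below : ∀ upd {Q A a} → KeepsOwn upd → ObservesOwn upd Q A → A a →
                      ObservesOwn upd (upd Q (Pₐ a)) (_≡ a)
  observesOwn-below upd {a = a} keeps observes Aa refl =
    trans (cong (λ Q → upd Q (Pₐ a)) (observes Aa)) (keeps a)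

  sat-transfer : ∀ {A φ} → NonAlternating A φ →
                 (u₁ : Update n) {Q₁ : Subset n} → KeepsOwn u₁ → ObservesOwn u₁ Q₁ A →
                 (u₂ : Update n) {Q₂ : Subset n} → KeepsOwn u₂ → ObservesOwn u₂ Q₂ A →
                 ∀ {f h} → Sat 𝔗 u₁ Q₁ φ f h → Sat 𝔗 u₂ Q₂ φ f h
  sat-transfer tt      _ _ _ _ _ _ s = s
  sat-transfer (var p) _ _ _ _ _ _ s = s
  sat-transfer (¬′ d) u₁ k₁ o₁ u₂ k₂ o₂ ¬s = ¬s ∘ sat-transfer d u₂ k₂ o₂ u₁ k₁ o₁
  sat-transfer (d ∧′ e) u₁ k₁ o₁ u₂ k₂ o₂ (s , t) =
    sat-transfer d u₁ k₁ o₁ u₂ k₂ o₂ s , sat-transfer e u₁ k₁ o₁ u₂ k₂ o₂ t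
  sat-transfer (○ d) u₁ k₁ o₁ u₂ k₂ o₂ s = sat-transfer d u₁ k₁ o₁ u₂ k₂ o₂ s
  sat-transfer (d U e) u₁ k₁ o₁ u₂ k₂ o₂ (ℓ , s , before) =
    ℓ , sat-transfer e u₁ k₁ o₁ u₂ k₂ o₂ s , λ j j<ℓ → sat-transfer d u₁ k₁ o₁ u₂ k₂ o₂ (before j j<ℓ)
  sat-transfer (⟨_⟩_ {a} Aa d) u₁ k₁ o₁ u₂ k₂ o₂ {h = h} (h′ , t , f′ , reach , trace , last≡ , obs≡ , s) =
    h′ , t , f′ , reach , trace , last≡ ,
    subst (λ O → map⁺ (_∩ O) h ≡ map⁺ (_∩ O) h′) (trans (o₁ Aa) (sym (o₂ Aa))) obs≡ ,
    sat-transfer d u₁ k₁ (observesOwn-below u₁ k₁ o₁ Aa) u₂ k₂ (observesOwn-below u₂ k₂ o₂ Aa) s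

  models-⇔ : ∀ {φ} → NonAlternating (λ _ → ⊤) φ → ∀ {upd₁ Q₁ upd₂ Q₂} →
             ObservationBased upd₁ Q₁ → ObservationBased upd₂ Q₂ →
             Models 𝔗 upd₁ Q₁ φ ⇔ Models 𝔗 upd₂ Q₂ φ
  models-⇔ d {upd₁} {_} {upd₂} (k₁ , o₁) (k₂ , o₂) =
    mk⇔ (λ M f tr → sat-transfer d upd₁ k₁ o₁ upd₂ k₂ o₂ (M f tr))
        (λ M f tr → sat-transfer d upd₂ k₂ o₂ upd₁ k₁ o₁ (M f tr))

  pobs-observationBased : ObservationBased (λ _ P → P) ∅
  pobs-observationBased = (λ _ → refl) , λ _ → refl

  decr-observationBased : ObservationBased (λ Q P → Q ∩ P) Full
  decr-observationBased = (λ a → ∩-idem (Pₐ a)) , λ {a} _ → ∩-identityˡ (Pₐ a)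

  incr-observationBased : ObservationBased (λ Q P → Q ∪ P) ∅
  incr-observationBased = (λ a → ∪-idem (Pₐ a)) , λ {a} _ → ∪-identityˡ (Pₐ a)

fully-observed-history≡ : ∀ {n} (h h′ : FWord n) → map⁺ (_∩ Full) h ≡ map⁺ (_∩ Full) h′ → h ≡ h′
fully-observed-history≡ h h′ obs≡ = begin
  h                 ≡⟨ sym (unobserved h) ⟩
  map⁺ (_∩ Full) h  ≡⟨ obs≡ ⟩
  map⁺ (_∩ Full) h′ ≡⟨ unobserved h′ ⟩
  h′                ∎
  where
  open ≡-Reasoning
  unobserved : ∀ h → map⁺ (_∩ Full) h ≡ h
  unobserved h = trans (map-cong ∩-identityʳ h) (map-id h)

¬doubt-under-full-observation :
  ∀ {n m} (𝔗 : Structure n m) (upd : Update n) {Q} a p f →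
  upd Q (TS.R (Structure.Tₐ 𝔗 a)) ≡ Full → p ∈ f 0 → ¬ Sat 𝔗 upd Q (⟨ a ⟩ ¬′ var p) f [ f 0 ]
¬doubt-under-full-observation 𝔗 upd a p f full p∈f0 (h′ , _ , f′ , _ , _ , last≡ , obs≡ , p∉f′0) =
  p∉f′0 (subst (p ∈_) (trans (cong last [f0]≡h′) last≡) p∈f0)
  where
  [f0]≡h′ : [ f 0 ] ≡ h′
  [f0]≡h′ = fully-observed-history≡ _ _
              (subst (λ O → map⁺ (_∩ O) [ f 0 ] ≡ map⁺ (_∩ O) h′) full obs≡)

loop : ∀ {n} (R L : Subset n) → L ⊆ R → TS n
loop R L L⊆R = record
  { size = 1 ; step = λ _ _ → true ; total = λ _ → zero , refl ; init = zero
  ; R = R ; L = λ _ → L ; L⊆R = λ _ → L⊆R }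

loop-trace : ∀ {n} {R L : Subset n} (L⊆R : L ⊆ R) (ρ : Word n) → (∀ i → L ≡ ρ i) →
             Traces (loop R L L⊆R) zero ρ
loop-trace _ _ L≡ρ = (λ _ → zero) , (refl , λ _ → refl) , L≡ρ

p : Fin 1
p = zero

doubt : Formula 1 1
doubt = ⟨ zero ⟩ ¬′ var p

withAgent : TS 1 → Structure 1 1
withAgent T = record { T₀ = loop Full Full ⊆-refl ; T₀-R = refl ; Tₐ = λ _ → T }

sightedAgent blindAgent : TS 1
sightedAgent = loop Full ∅ (⊆-min Full)
blindAgent   = loop ∅ ∅ (⊆-min ∅)

withAgent-⊭doubt : ∀ T (upd : Update 1) → upd ∅ (TS.R T) ≡ Full →
                   ¬ Models (withAgent T) upd ∅ doubt
withAgent-⊭doubt T upd full M =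
  ¬doubt-under-full-observation (withAgent T) upd zero p (λ _ → Full) full ∈⊤
    (M _ (loop-trace ⊆-refl _ λ _ → refl))

withAgent-⊨doubt : ∀ R (upd : Update 1) → upd ∅ R ≡ ∅ →
                   Models (withAgent (loop R ∅ (⊆-min R))) upd ∅ doubt
withAgent-⊨doubt R upd unobserved f _ =
  [ ∅ ] , zero , (λ _ → ∅) , (sym (∩-zeroˡ R) , refl) ,
  loop-trace (⊆-min R) _ (λ _ → sym (∩-zeroˡ R)) , refl , cong [_] observedAlike , ∉⊥
  where
  open ≡-Reasoning
  observedAlike : f 0 ∩ upd ∅ R ≡ ∅ ∩ upd ∅ R
  observedAlike = begin
    f 0 ∩ upd ∅ R  ≡⟨ cong (f 0 ∩_) unobserved ⟩
    f 0 ∩ ∅        ≡⟨ ∩-zeroʳ (f 0) ⟩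
    ∅              ≡⟨ sym (∩-zeroˡ (upd ∅ R)) ⟩
    ∅ ∩ upd ∅ R    ∎

lemma3p7 :
      (∀ {n m : ℕ} (φ : Formula n m) → ad φ ≡ 1 → (𝔗 : Structure n m) →
         ((𝔗 ⊨pobs φ) ⇔ (𝔗 ⊨decr φ)) × ((𝔗 ⊨decr φ) ⇔ (𝔗 ⊨incr φ)))
    × (∃ λ (n : ℕ) → ∃ λ (m : ℕ) → ∃ λ (𝔗 : Structure n m) → ∃ λ (φ : Formula n m) →
         (ad φ ≡ 1) × Differ (𝔗 ⊨pobs φ) (𝔗 ⊨step φ))
    × (∃ λ (n : ℕ) → ∃ λ (m : ℕ) → ∃ λ (𝔗 : Structure n m) → ∃ λ (φ : Formula n m) →
         (ad φ ≡ 1) × Differ (𝔗 ⊨pobs φ) (𝔗 ⊨public φ))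
    × (∃ λ (n : ℕ) → ∃ λ (m : ℕ) → ∃ λ (𝔗 : Structure n m) → ∃ λ (φ : Formula n m) →
         (ad φ ≡ 1) × Differ (𝔗 ⊨public φ) (𝔗 ⊨step φ))
lemma3p7 =
    (λ φ ad≡1 𝔗 →
      let nonAlternating = ad≤1⇒nonAlternating φ (≤-reflexive ad≡1) in
      models-⇔ 𝔗 nonAlternating (pobs-observationBased 𝔗) (decr-observationBased 𝔗) ,
      models-⇔ 𝔗 nonAlternating (decr-observationBased 𝔗) (incr-observationBased 𝔗))
  , (1 , 1 , withAgent sightedAgent , doubt , refl ,
     inj₂ (withAgent-⊭doubt sightedAgent (λ _ P → P) refl , withAgent-⊨doubt Full (λ _ _ → ∅) refl))
  , (1 , 1 , withAgent blindAgent , doubt , refl ,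
     inj₁ (withAgent-⊨doubt ∅ (λ _ P → P) refl , withAgent-⊭doubt blindAgent (λ _ _ → Full) refl))
  , (1 , 1 , withAgent sightedAgent , doubt , refl ,
     inj₂ (withAgent-⊭doubt sightedAgent (λ _ _ → Full) refl , withAgent-⊨doubt Full (λ _ _ → ∅) refl))
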